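{- Let $n\geq 2$ and $j\geq 3$ be integers. Then \[ m_j(K_3,K_{1,n})=\Big\lfloor \frac{n-1}{\lceil \frac{j}{2}\rceil-1}\Big\rfloor+1 . \]
   Context: All graphs are simple; $K_3$ is the triangle and $K_{1,n}$ is the star with $n+1$ vertices ($n$ leaves). For integers $j\geq 2$ and $t\geq 1$, $K_{j\times t}$ denotes the complete multipartite graph with $j$ parts, each of size $t$. For graphs $H$ and $G$, the size multipartite Ramsey number $m_j(H,G)$ is the smallest natural number $t$ such that every coloring of the edges of $K_{j\times t}$ with two colors red and blue contains a red copy of $H$ or a blue copy of $G$ as a subgraph. -}

module Defs where

open import Data.Nat using (ℕ; zero; suc; _+_; _∸_; _≤_; _<_)
open import Data.Nat.DivMod using (_/_)
open import Data.Fin using (Fin)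
open import Data.Bool using (Bool; true; false)
open import Data.Product using (_×_; Σ; ∃; proj₁; proj₂)
open import Data.Sum using (_⊎_)
open import Relation.Binary.PropositionalEquality using (_≡_)
open import Relation.Nullary using (¬_)
open import Function.Definitions using (Injective)

-- Vertices of the complete multipartite graph K_{j×t}: (part, index in part).
Vertex : ℕ → ℕ → Set
Vertex j t = Fin j × Fin t

Adj : ∀ {j t} → Vertex j t → Vertex j t → Set
Adj u v = ¬ (proj₁ u ≡ proj₁ v)

-- A 2-colouring of the edges of K_{j×t}: true = red, false = blue.
-- Given on ordered pairs, required symmetric, so it is a colouring of edges
-- (values on non-adjacent pairs are irrelevant).
record Colouring (j t : ℕ) : Set where
  field
    col : Vertex j t → Vertex j t → Bool
    sym : ∀ u v → col u v ≡ col v u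
open Colouring public

red blue : Bool
red = true
blue = false

HasRedK3 : ∀ {j t} → Colouring j t → Set
HasRedK3 {j} {t} c =
  Σ (Vertex j t) λ a → Σ (Vertex j t) λ b → Σ (Vertex j t) λ d →
    (Adj a b × Adj b d × Adj a d) ×
    (col c a b ≡ red × col c b d ≡ red × col c a d ≡ red)

HasBlueStar : ∀ {j t} → ℕ → Colouring j t → Set
HasBlueStar {j} {t} n c =
  Σ (Vertex j t) λ v → Σ (Fin n → Vertex j t) λ f →
    Injective _≡_ _≡_ f × (∀ i → Adj v (f i) × col c v (f i) ≡ blue)

Arrows : ℕ → ℕ → ℕ → Set
Arrows j t n = (c : Colouring j t) → HasRedK3 c ⊎ HasBlueStar n c

IsSizeMultipartiteRamsey : ℕ → ℕ → ℕ → Set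
IsSizeMultipartiteRamsey j n m =
  1 ≤ m × Arrows j m n × (∀ t → 1 ≤ t → t < m → ¬ Arrows j t n)

ceilHalf : ℕ → ℕ
ceilHalf j = (j + 1) / 2

-- ⌊ a / b ⌋ (only used with b ≥ 1; returns 0 when b = 0)
floorDiv : ℕ → ℕ → ℕ
floorDiv a zero = 0
floorDiv a (suc b) = a / suc b

{-# OPTIONS --safe #-}
module Submission where

-- Write j = 1 + k + h with k = ⌈j/2⌉ − 1 ≤ h ≤ k + 1, and let q = ⌊(n − 1)/k⌋.
--
-- Lower bound (t ≤ q): colour red exactly the edges between the first k + 1 parts and the
-- other h parts. The red graph is bipartite, and a vertex has blue neighbours only in the
-- at most k other parts of its own side, so at most k t ≤ k q < n of them.
--
-- Upper bound (t = q + 1, so k t ≥ n): in a colouring without red triangle some vertex has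
-- red degree at most h t, hence blue degree at least (j − 1) t − h t = k t. To find it, keep
-- a vertex w and a set S of between k and h parts. If all red neighbours of w lie in S, then
-- w will do. Otherwise w has a red neighbour y in some part Q ∉ S; the set S′ of parts
-- outside S ∪ {Q} again has between k and h elements. The red neighbourhoods of w and y are
-- disjoint, so deg y ≤ |S| t − deg_S w + deg_S′ y: either deg y ≤ h t, or y and S′ have a
-- larger value of deg_S′ y than w and S had. That value never exceeds h t, so this stops.

open import Defs hiding (sym)
open import Data.Bool using (Bool; true; false; not; _∧_; _xor_; if_then_else_; T)
open import Data.Bool.Properties
  using (T-∧; T-≡; T-not-≡; xor-comm; xor-same; not-involutive; ∧-identityʳ; ∧-zeroʳ)
open import Data.Empty using (⊥; ⊥-elim)
open import Data.Fin using (Fin; zero; suc; toℕ; _↑ˡ_; _↑ʳ_; combine; remQuot; inject≤; fromℕ<)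
open import Data.Fin.Properties
  using (_≟_; inject≤-injective; remQuot-combine; combine-remQuot; combine-injective; injective⇒≤)
import Data.Fin.Properties as Fin
open import Data.Nat
  using (ℕ; zero; suc; _+_; _*_; _∸_; _/_; _%_; _≤_; _<_; z≤n; s≤s; _<ᵇ_; _≤?_; NonZero)
open import Data.Nat.DivMod using (m≡m%n+[m/n]*n; m%n<n; m/n*n≤m; m/n≡1+[m∸n]/n)
open import Data.Nat.Properties hiding (_≟_)
open import Algebra.Properties.CommutativeMonoid.Sum +-0-commutativeMonoid
  using (sum; sum-syntax; sum-cong-≗; ∑-distrib-+)
open import Data.Product using (Σ; ∃; ∃₂; _×_; _,_; proj₁; proj₂; uncurry)
open import Data.Product.Properties using (×-≡,≡→≡)
open import Data.Sum using (_⊎_; inj₁; inj₂; map₂)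
open import Data.Unit using (tt)
open import Function using (_∘_; Equivalence)
open import Function.Definitions using (Injective)
open import Relation.Binary.PropositionalEquality
  using (_≡_; _≢_; refl; sym; trans; cong; subst; module ≡-Reasoning)
open import Relation.Nullary using (¬_; yes; no; does; contradiction)
open import Relation.Nullary.Decidable using (dec-true; dec-false)

-- Counting over Fin

indicator : Bool → ℕ
indicator true = 1
indicator false = 0

sum-mono-≤ : ∀ {n} {f g : Fin n → ℕ} → (∀ i → f i ≤ g i) → sum f ≤ sum g
sum-mono-≤ {zero} f≤g = z≤n
sum-mono-≤ {suc n} f≤g = +-mono-≤ (f≤g zero) (sum-mono-≤ (f≤g ∘ suc))

sum-*ʳ : ∀ {n} (f : Fin n → ℕ) c → sum (λ i → f i * c) ≡ sum f * c
sum-*ʳ {zero} f c = refl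
sum-*ʳ {suc n} f c = trans (cong (f zero * c +_) (sum-*ʳ (f ∘ suc) c))
                           (sym (*-distribʳ-+ c (f zero) _))

sum-↑ : ∀ m {n} (f : Fin (m + n) → ℕ) →
        sum f ≡ sum (λ i → f (i ↑ˡ n)) + sum (λ i → f (m ↑ʳ i))
sum-↑ zero f = refl
sum-↑ (suc m) f = trans (cong (f zero +_) (sum-↑ m (f ∘ suc))) (sym (+-assoc (f zero) _ _))

sum-combine : ∀ m {n} (f : Fin (m * n) → ℕ) →
              sum f ≡ ∑[ i < m ] ∑[ j < n ] f (combine i j)
sum-combine zero f = refl
sum-combine (suc m) {n} f =
  trans (sum-↑ n f) (cong (sum (λ j → f (j ↑ˡ (m * n))) +_) (sum-combine m (λ i → f (n ↑ʳ i))))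

count : ∀ {n} → (Fin n → Bool) → ℕ
count p = sum (λ i → indicator (p i))

count-≤ : ∀ {n} (p : Fin n → Bool) → count p ≤ n
count-≤ {zero} p = z≤n
count-≤ {suc n} p = +-mono-≤ (indicator≤1 (p zero)) (count-≤ (p ∘ suc))
  where
  indicator≤1 : ∀ b → indicator b ≤ 1
  indicator≤1 true = ≤-refl
  indicator≤1 false = z≤n

count-const : ∀ n b → count {n} (λ _ → b) ≡ indicator b * n
count-const zero b = sym (*-zeroʳ (indicator b))
count-const (suc n) b = trans (cong (indicator b +_) (count-const n b)) (sym (*-suc (indicator b) n))

count-true : ∀ n → count {n} (λ _ → true) ≡ n
count-true n = trans (count-const n true) (*-identityˡ n)

count-∧-split : ∀ {n} (q p : Fin n → Bool) →
                count (λ i → q i ∧ p i) + count (λ i → q i ∧ not (p i)) ≡ count q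
count-∧-split q p =
  trans (sym (∑-distrib-+ (λ i → indicator (q i ∧ p i)) (λ i → indicator (q i ∧ not (p i)))))
        (sum-cong-≗ λ i → split (q i) (p i))
  where
  split : ∀ a b → indicator (a ∧ b) + indicator (a ∧ not b) ≡ indicator a
  split true true = refl
  split true false = refl
  split false _ = refl

count-complement : ∀ {n} (p : Fin n → Bool) → count p + count (not ∘ p) ≡ n
count-complement {n} p = trans (count-∧-split (λ _ → true) p) (count-true n)

distinct : ∀ {n} → Fin n → Fin n → Bool
distinct a b = not (does (a ≟ b))

distinct⇒≢ : ∀ {n} {a b : Fin n} → T (distinct a b) → a ≢ b
distinct⇒≢ {a = a} t refl = subst (T ∘ not) (dec-true (a ≟ a) refl) t

≢⇒distinct : ∀ {n} {a b : Fin n} → a ≢ b → T (distinct a b)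
≢⇒distinct {a = a} {b} a≢b = subst (T ∘ not) (sym (dec-false (a ≟ b) a≢b)) tt

distinct-refl : ∀ {n} (a : Fin n) → distinct a a ≡ false
distinct-refl a = cong not (dec-true (a ≟ a) refl)

count-except : ∀ {n} (p : Fin n → Bool) (a : Fin n) → T (p a) →
               suc (count (λ i → distinct a i ∧ p i)) ≡ count p
count-except p zero pa with p zero
... | true = refl
count-except p (suc a) pa =
  trans (sym (+-suc (indicator (p zero)) _)) (cong (indicator (p zero) +_) (count-except (p ∘ suc) a pa))

count-distinct : ∀ {n} (a : Fin n) → suc (count (distinct a)) ≡ n
count-distinct {n} a = begin
  suc (count (distinct a))
    ≡⟨ cong suc (sum-cong-≗ λ i → cong indicator (sym (∧-identityʳ (distinct a i)))) ⟩
  suc (count (λ i → distinct a i ∧ true))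
    ≡⟨ count-except (λ _ → true) a tt ⟩
  count {n} (λ _ → true)
    ≡⟨ count-true n ⟩
  n ∎
  where open ≡-Reasoning

firstParts : ∀ {n} → ℕ → Fin n → Bool
firstParts c i = toℕ i <ᵇ c

count-firstParts : ∀ {n c} → c ≤ n → count {n} (firstParts c) ≡ c
count-firstParts {zero} z≤n = refl
count-firstParts {suc n} {zero} z≤n = count-const n false
count-firstParts {suc n} {suc c} (s≤s c≤n) = cong suc (count-firstParts c≤n)

∃-or-∀ : ∀ {n} {A B : Fin n → Set} → (∀ i → A i ⊎ B i) → ∃ A ⊎ (∀ i → B i)
∃-or-∀ {zero} A⊎B = inj₂ λ ()
∃-or-∀ {suc n} A⊎B with A⊎B zero | ∃-or-∀ (A⊎B ∘ suc)
... | inj₁ a | _ = inj₁ (zero , a)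
... | inj₂ _ | inj₁ (i , a) = inj₁ (suc i , a)
... | inj₂ b | inj₂ bs = inj₂ λ { zero → b ; (suc i) → bs i }

count-pos⇒witness : ∀ {n} (p : Fin n → Bool) → 0 < count p → ∃ λ i → T (p i)
count-pos⇒witness {suc n} p pos with p zero in p0
... | true = zero , subst T (sym p0) tt
... | false = let (i , pi) = count-pos⇒witness (p ∘ suc) pos in suc i , pi

common-or-count-+-≤ : ∀ {n} (p q : Fin n → Bool) →
                      (∃ λ i → T (p i) × T (q i)) ⊎ count p + count q ≤ n
common-or-count-+-≤ {n} p q = map₂ bound (∃-or-∀ λ i → common-or-≤1 (p i) (q i))
  where
  common-or-≤1 : ∀ a b → (T a × T b) ⊎ indicator a + indicator b ≤ 1
  common-or-≤1 true  true  = inj₁ (tt , tt)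
  common-or-≤1 true  false = inj₂ ≤-refl
  common-or-≤1 false true  = inj₂ ≤-refl
  common-or-≤1 false false = inj₂ z≤n
  bound : (∀ i → indicator (p i) + indicator (q i) ≤ 1) → count p + count q ≤ n
  bound ≤1 = begin
    count p + count q
      ≡⟨ ∑-distrib-+ (λ i → indicator (p i)) (λ i → indicator (q i)) ⟨
    sum (λ i → indicator (p i) + indicator (q i))
      ≤⟨ sum-mono-≤ ≤1 ⟩
    count {n} (λ _ → true)
      ≡⟨ count-true n ⟩
    n ∎
    where open ≤-Reasoning

select : ∀ {n} (p : Fin n → Bool) → Fin (count p) → Fin n
select {suc n} p i with p zero
select {suc n} p zero    | true = zero
select {suc n} p (suc i) | true = suc (select (p ∘ suc) i)
select {suc n} p i       | false = suc (select (p ∘ suc) i)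

select-T : ∀ {n} (p : Fin n → Bool) i → T (p (select p i))
select-T {suc n} p i with p zero in p0
select-T {suc n} p zero    | true = subst T (sym p0) tt
select-T {suc n} p (suc i) | true = select-T (p ∘ suc) i
select-T {suc n} p i       | false = select-T (p ∘ suc) i

select-injective : ∀ {n} (p : Fin n → Bool) → Injective _≡_ _≡_ (select p)
select-injective {suc n} p {i} {i′} with p zero
select-injective {suc n} p {zero}  {zero}   | true = λ _ → refl
select-injective {suc n} p {zero}  {suc _}  | true = λ ()
select-injective {suc n} p {suc _} {zero}   | true = λ ()
select-injective {suc n} p {suc i} {suc i′} | true =
  cong suc ∘ select-injective (p ∘ suc) ∘ Fin.suc-injective
select-injective {suc n} p {i} {i′} | false =
  select-injective (p ∘ suc) ∘ Fin.suc-injective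

rank : ∀ {n} (p : Fin n → Bool) x → T (p x) → Fin (count p)
rank {suc n} p zero px with p zero
... | true = zero
rank {suc n} p (suc x) px with p zero
... | true = suc (rank (p ∘ suc) x px)
... | false = rank (p ∘ suc) x px

rank-injective : ∀ {n} (p : Fin n → Bool) x y px py → rank p x px ≡ rank p y py → x ≡ y
rank-injective {suc n} p zero zero px py _ = refl
rank-injective {suc n} p zero (suc y) px py with p zero
... | true = λ ()
rank-injective {suc n} p (suc x) zero px py with p zero
... | true = λ ()
rank-injective {suc n} p (suc x) (suc y) px py with p zero
... | true = cong suc ∘ rank-injective (p ∘ suc) x y px py ∘ Fin.suc-injective
... | false = cong suc ∘ rank-injective (p ∘ suc) x y px py

≤count⇒injection : ∀ {m n} (p : Fin n → Bool) → m ≤ count p →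
                   Σ (Fin m → Fin n) λ f → Injective _≡_ _≡_ f × (∀ i → T (p (f i)))
≤count⇒injection p m≤count =
  (λ i → select p (inject≤ i m≤count)) ,
  (λ {i} {i′} eq → inject≤-injective m≤count m≤count i i′ (select-injective p eq)) ,
  (λ i → select-T p (inject≤ i m≤count))

injective⇒≤count : ∀ {m n} (p : Fin n → Bool) (f : Fin m → Fin n) →
                   Injective _≡_ _≡_ f → (∀ i → T (p (f i))) → m ≤ count p
injective⇒≤count p f f-inj pf = injective⇒≤
  λ {i} {i′} eq → f-inj (rank-injective p (f i) (f i′) (pf i) (pf i′) eq)

countVertices : ∀ {j t} → (Vertex j t → Bool) → ℕ
countVertices {j} {t} p = ∑[ Q < j ] count (λ b → p (Q , b))

countVertices-∧-split : ∀ {j t} (q p : Vertex j t → Bool) →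
  countVertices (λ x → q x ∧ p x) + countVertices (λ x → q x ∧ not (p x)) ≡ countVertices q
countVertices-∧-split q p =
  trans (sym (∑-distrib-+ (λ Q → count (λ b → q (Q , b) ∧ p (Q , b)))
                          (λ Q → count (λ b → q (Q , b) ∧ not (p (Q , b))))))
        (sum-cong-≗ λ Q → count-∧-split (λ b → q (Q , b)) (λ b → p (Q , b)))

countVertices-byPart : ∀ {j t} (q : Fin j → Bool) →
                       countVertices {j} {t} (λ x → q (proj₁ x)) ≡ count q * t
countVertices-byPart {t = t} q =
  trans (sum-cong-≗ λ Q → count-const t (q Q)) (sum-*ʳ (λ Q → indicator (q Q)) t)

countVertices≡count∘remQuot : ∀ {j t} (p : Vertex j t → Bool) →
                              countVertices p ≡ count (λ i → p (remQuot t i))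
countVertices≡count∘remQuot {j} {t} p = sym (trans (sum-combine j (λ i → indicator (p (remQuot t i))))
  (sum-cong-≗ λ Q → sum-cong-≗ λ b → cong (indicator ∘ p) (remQuot-combine Q b)))

≤countVertices⇒injection : ∀ {n j t} (p : Vertex j t → Bool) → n ≤ countVertices p →
  Σ (Fin n → Vertex j t) λ f → Injective _≡_ _≡_ f × (∀ i → T (p (f i)))
≤countVertices⇒injection {j = j} {t} p n≤count
  with ≤count⇒injection (λ i → p (remQuot t i))
                        (subst (_ ≤_) (countVertices≡count∘remQuot p) n≤count)
... | f , f-inj , pf = remQuot t ∘ f , f-inj ∘ remQuot-injective , pf
  where
  remQuot-injective : ∀ {i i′} → remQuot {j} t i ≡ remQuot t i′ → i ≡ i′
  remQuot-injective {i} {i′} eq =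
    trans (sym (combine-remQuot {j} t i)) (trans (cong (uncurry combine) eq) (combine-remQuot {j} t i′))

injective⇒≤countVertices : ∀ {n j t} (p : Vertex j t → Bool) (f : Fin n → Vertex j t) →
  Injective _≡_ _≡_ f → (∀ i → T (p (f i))) → n ≤ countVertices p
injective⇒≤countVertices {t = t} p f f-inj pf =
  subst (_ ≤_) (sym (countVertices≡count∘remQuot p))
    (injective⇒≤count (λ i → p (remQuot t i)) (uncurry combine ∘ f) combine-f-injective
      λ i → subst (T ∘ p) (sym (remQuot-combine (proj₁ (f i)) (proj₂ (f i)))) (pf i))
  where
  combine-f-injective : Injective _≡_ _≡_ (uncurry combine ∘ f)
  combine-f-injective {i} {i′} eq =
    f-inj (×-≡,≡→≡ (combine-injective (proj₁ (f i)) (proj₂ (f i)) (proj₁ (f i′)) (proj₂ (f i′))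
                                      eq))

restrict : ∀ {n} → (Fin n → Bool) → (Fin n → ℕ) → Fin n → ℕ
restrict S f i = if S i then f i else 0

sum-restrict-≤ : ∀ {n c} (S : Fin n → Bool) {f : Fin n → ℕ} → (∀ i → f i ≤ c) →
                 sum (restrict S f) ≤ count S * c
sum-restrict-≤ {c = c} S {f} f≤c =
  ≤-trans (sum-mono-≤ λ i → restrict≤ (S i) (f≤c i))
          (≤-reflexive (sum-*ʳ (λ i → indicator (S i)) c))
  where
  restrict≤ : ∀ {x} b → x ≤ c → (if b then x else 0) ≤ indicator b * c
  restrict≤ true x≤c = ≤-trans x≤c (≤-reflexive (sym (+-identityʳ c)))
  restrict≤ false _ = z≤n

sum-restrict-+ : ∀ {n} (S : Fin n → Bool) (f g : Fin n → ℕ) →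
                 sum (restrict S f) + sum (restrict S g) ≡ sum (restrict S (λ i → f i + g i))
sum-restrict-+ S f g = trans (sym (∑-distrib-+ (restrict S f) (restrict S g)))
                             (sum-cong-≗ λ i → restrict-+ (S i))
  where
  restrict-+ : ∀ {x y} b → (if b then x else 0) + (if b then y else 0) ≡ (if b then x + y else 0)
  restrict-+ true = refl
  restrict-+ false = refl

outside : ∀ {n} → (Fin n → Bool) → Fin n → Fin n → Bool
outside S Q i = distinct Q i ∧ not (S i)

sum-restrict-outside : ∀ {n} (S : Fin n → Bool) {Q} (f : Fin n → ℕ) → f Q ≡ 0 →
                       sum f ≡ sum (restrict S f) + sum (restrict (outside S Q) f)
sum-restrict-outside S {Q} f fQ≡0 =
  trans (sum-cong-≗ λ i → split i (S i)) (∑-distrib-+ (restrict S f) (restrict (outside S Q) f))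
  where
  split : ∀ i b → f i ≡ (if b then f i else 0) + (if distinct Q i ∧ not b then f i else 0)
  split i true rewrite ∧-zeroʳ (distinct Q i) = sym (+-identityʳ (f i))
  split i false with Q ≟ i
  ... | yes refl = fQ≡0
  ... | no _ = refl

count-outside : ∀ {n} (S : Fin n → Bool) {Q} → T (not (S Q)) → count S + suc (count (outside S Q)) ≡ n
count-outside S {Q} Q∉S = trans (cong (count S +_) (count-except (not ∘ S) Q Q∉S)) (count-complement S)

-- A vertex of small degree in a triangle-free multipartite graph

mirror-bounds : ∀ {a b k h} → a + b ≡ k + h → k ≤ a → a ≤ h → k ≤ b × b ≤ h
mirror-bounds {a} {b} {k} {h} a+b≡k+h k≤a a≤h =
  +-cancelˡ-≤ a k b (begin
    a + k  ≤⟨ +-monoˡ-≤ k a≤h ⟩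
    h + k  ≡⟨ +-comm h k ⟩
    k + h  ≡⟨ a+b≡k+h ⟨
    a + b  ∎) ,
  +-cancelˡ-≤ a b h (begin
    a + b  ≡⟨ a+b≡k+h ⟩
    k + h  ≤⟨ +-monoˡ-≤ h k≤a ⟩
    a + h  ∎)
  where open ≤-Reasoning

-- A j-partite graph with parts of size t, seen through the number d u Q of neighbours of u
-- in part Q. The hypothesis disjoint-neighbour is triangle-freeness: the neighbourhoods of
-- adjacent vertices are disjoint, unless an obstruction X (a red triangle) turns up.
module LowDegree
  {V : Set} {j t : ℕ} (part : V → Fin j) (d : V → Fin j → ℕ)
  (d≤t : ∀ u Q → d u Q ≤ t) (d-part : ∀ u → d u (part u) ≡ 0)
  {X : Set} (disjoint-neighbour : ∀ w Q → 0 < d w Q →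
                                  X ⊎ ∃ λ y → part y ≡ Q × (∀ Q′ → d w Q′ + d y Q′ ≤ t))
  {k h : ℕ} (j≡ : suc (k + h) ≡ j) (k≤h : k ≤ h) where

  deg : V → ℕ
  deg u = sum (d u)

  degIn : V → (Fin j → Bool) → ℕ
  degIn u S = sum (restrict S (d u))

  Balanced : (Fin j → Bool) → Set
  Balanced S = k ≤ count S × count S ≤ h

  Conclusion : Set
  Conclusion = X ⊎ ∃ λ u → deg u ≤ h * t

  degIn-≤ : ∀ u {S} → Balanced S → degIn u S ≤ h * t
  degIn-≤ u {S} (_ , S≤h) = ≤-trans (sum-restrict-≤ S (d≤t u)) (*-monoˡ-≤ t S≤h)

  outside-balanced : ∀ {S Q} → T (not (S Q)) → Balanced S → Balanced (outside S Q)
  outside-balanced {S} {Q} Q∉S (k≤S , S≤h) = mirror-bounds sizes k≤S S≤h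
    where
    sizes : count S + count (outside S Q) ≡ k + h
    sizes = suc-injective (trans (sym (+-suc _ _)) (trans (count-outside S Q∉S) (sym j≡)))

  deg-neighbour : ∀ {w y S} → (∀ Q′ → d w Q′ + d y Q′ ≤ t) → Balanced S →
                  degIn w S + deg y ≤ h * t + degIn y (outside S (part y))
  deg-neighbour {w} {y} {S} disjoint (_ , S≤h) = begin
    degIn w S + deg y
      ≡⟨ cong (degIn w S +_) (sum-restrict-outside S (d y) (d-part y)) ⟩
    degIn w S + (degIn y S + degIn y S′)
      ≡⟨ +-assoc (degIn w S) _ _ ⟨
    degIn w S + degIn y S + degIn y S′
      ≡⟨ cong (_+ degIn y S′) (sum-restrict-+ S (d w) (d y)) ⟩
    sum (restrict S (λ Q′ → d w Q′ + d y Q′)) + degIn y S′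
      ≤⟨ +-monoˡ-≤ _ (sum-restrict-≤ S disjoint) ⟩
    count S * t + degIn y S′
      ≤⟨ +-monoˡ-≤ _ (*-monoˡ-≤ t S≤h) ⟩
    h * t + degIn y S′ ∎
    where
    open ≤-Reasoning
    S′ = outside S (part y)

  escapes-or-inside : ∀ u S Q → (T (not (S Q)) × 0 < d u Q) ⊎ d u Q ≡ restrict S (d u) Q
  escapes-or-inside u S Q with S Q | d u Q
  ... | true  | _     = inj₂ refl
  ... | false | zero  = inj₂ refl
  ... | false | suc _ = inj₁ (tt , s≤s z≤n)

  step : ∀ w S → Balanced S → Conclusion ⊎ ∃₂ λ y S′ → Balanced S′ × degIn w S < degIn y S′
  step w S bal with ∃-or-∀ (escapes-or-inside w S)
  ... | inj₂ inside = inj₁ (inj₂ (w , ≤-trans (≤-reflexive (sum-cong-≗ inside)) (degIn-≤ w bal)))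
  ... | inj₁ (Q , Q∉S , 0<dwQ) with disjoint-neighbour w Q 0<dwQ
  ...   | inj₁ x = inj₁ (inj₁ x)
  ...   | inj₂ (y , refl , disjoint) with degIn y (outside S (part y)) ≤? degIn w S
  ...     | no y≰w = inj₂ (y , outside S (part y) , outside-balanced Q∉S bal , ≰⇒> y≰w)
  ...     | yes y≤w = inj₁ (inj₂ (y , +-cancelˡ-≤ (degIn w S) _ _ (begin
    degIn w S + deg y                      ≤⟨ deg-neighbour disjoint bal ⟩
    h * t + degIn y (outside S (part y))   ≤⟨ +-monoʳ-≤ (h * t) y≤w ⟩
    h * t + degIn w S                      ≡⟨ +-comm (h * t) _ ⟩
    degIn w S + h * t                      ∎)))
    where open ≤-Reasoning

  climb : ∀ fuel w S → Balanced S → h * t ≤ degIn w S + fuel → Conclusion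
  climb fuel w S bal room with step w S bal
  ... | inj₁ done = done
  climb zero w S bal room | inj₂ (y , S′ , bal′ , w<y) =
    contradiction (≤-trans w<y (degIn-≤ y bal′)) (≤⇒≯ (subst (h * t ≤_) (+-identityʳ _) room))
  climb (suc fuel) w S bal room | inj₂ (y , S′ , bal′ , w<y) =
    climb fuel y S′ bal′ (≤-trans room (≤-trans (≤-reflexive (+-suc _ fuel)) (+-monoˡ-≤ fuel w<y)))

  low-degree-vertex : V → Conclusion
  low-degree-vertex w = climb (h * t) w S₀ (k≤S₀ , S₀≤h) (m≤n+m (h * t) _)
    where
    S₀ : Fin j → Bool
    S₀ = firstParts k
    |S₀| : count S₀ ≡ k
    |S₀| = count-firstParts (≤-trans (m≤m+n k h) (≤-trans (n≤1+n _) (≤-reflexive j≡)))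
    k≤S₀ : k ≤ count S₀
    k≤S₀ = ≤-reflexive (sym |S₀|)
    S₀≤h : count S₀ ≤ h
    S₀≤h = ≤-trans (≤-reflexive |S₀|) k≤h

-- The upper bound

redEdge blueEdge : ∀ {j t} → Colouring j t → Vertex j t → Vertex j t → Bool
redEdge  c u x = distinct (proj₁ u) (proj₁ x) ∧ col c u x
blueEdge c u x = distinct (proj₁ u) (proj₁ x) ∧ not (col c u x)

redEdge-sound : ∀ {j t} (c : Colouring j t) {u x} → T (redEdge c u x) → Adj u x × col c u x ≡ red
redEdge-sound c e = let adj , r = Equivalence.to T-∧ e in distinct⇒≢ adj , Equivalence.to T-≡ r

blueEdge-sound : ∀ {j t} (c : Colouring j t) {u x} → T (blueEdge c u x) → Adj u x × col c u x ≡ blue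
blueEdge-sound c e = let adj , b = Equivalence.to T-∧ e in distinct⇒≢ adj , Equivalence.to T-not-≡ b

blueEdge-complete : ∀ {j t} (c : Colouring j t) {u x} → Adj u x → col c u x ≡ blue → T (blueEdge c u x)
blueEdge-complete c adj b = Equivalence.from T-∧ (≢⇒distinct adj , Equivalence.from T-not-≡ b)

module _ {j t : ℕ} (c : Colouring j t) where

  redIn : Vertex j t → Fin j → ℕ
  redIn u Q = count (λ b → redEdge c u (Q , b))

  redIn-part : ∀ u → redIn u (proj₁ u) ≡ 0
  redIn-part (P , i) =
    trans (sum-cong-≗ λ b → cong (λ s → indicator (s ∧ col c (P , i) (P , b))) (distinct-refl P))
          (count-const t false)

  red-triangle-or-disjoint : ∀ w Q → 0 < redIn w Q →
    HasRedK3 c ⊎ ∃ λ y → proj₁ y ≡ Q × (∀ Q′ → redIn w Q′ + redIn y Q′ ≤ t)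
  red-triangle-or-disjoint w Q 0<redIn
    with count-pos⇒witness (λ b → redEdge c w (Q , b)) 0<redIn
  ... | b , wy with ∃-or-∀ (λ Q′ → common-or-count-+-≤ (λ b′ → redEdge c w (Q′ , b′))
                                                       (λ b′ → redEdge c (Q , b) (Q′ , b′)))
  ...   | inj₂ disjoint = inj₂ ((Q , b) , refl , disjoint)
  ...   | inj₁ (Q′ , b′ , wx , yx) =
    let (w-y , wy-red) = redEdge-sound c wy
        (y-x , yx-red) = redEdge-sound c yx
        (w-x , wx-red) = redEdge-sound c wx
    in inj₁ (w , (Q , b) , (Q′ , b′) , (w-y , y-x , w-x) , (wy-red , yx-red , wx-red))

  low-red⇒high-blue : ∀ {k h} → suc (k + h) ≡ j → ∀ u →
                      countVertices (redEdge c u) ≤ h * t → k * t ≤ countVertices (blueEdge c u)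
  low-red⇒high-blue {k} {h} j≡ u red≤ht = +-cancelʳ-≤ (h * t) (k * t) blueDeg (begin
    k * t + h * t
      ≡⟨ *-distribʳ-+ t k h ⟨
    (k + h) * t
      ≡⟨ cong (_* t) (suc-injective (trans j≡ (sym (count-distinct pu)))) ⟩
    count (distinct pu) * t
      ≡⟨ countVertices-byPart {t = t} (distinct pu) ⟨
    countVertices {t = t} (distinct pu ∘ proj₁)
      ≡⟨ countVertices-∧-split {t = t} (distinct pu ∘ proj₁) (col c u) ⟨
    countVertices (redEdge c u) + blueDeg
      ≤⟨ +-monoˡ-≤ blueDeg red≤ht ⟩
    h * t + blueDeg
      ≡⟨ +-comm (h * t) blueDeg ⟩
    blueDeg + h * t ∎)
    where
    open ≤-Reasoning
    pu = proj₁ u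
    blueDeg = countVertices (blueEdge c u)

  blue-star : ∀ {n} u → n ≤ countVertices (blueEdge c u) → HasBlueStar n c
  blue-star u n≤blue with ≤countVertices⇒injection (blueEdge c u) n≤blue
  ... | f , f-inj , f-blue = u , f , f-inj , λ i → blueEdge-sound c (f-blue i)

upper-bound : ∀ {j t n k h} → suc (k + h) ≡ j → k ≤ h → 0 < t → n ≤ k * t → Arrows j t n
upper-bound {j} {t} {n} {k} {h} j≡ k≤h 0<t n≤kt c = map₂ star (low-degree-vertex some-vertex)
  where
  open LowDegree proj₁ (redIn c) (λ _ _ → count-≤ _) (redIn-part c) (red-triangle-or-disjoint c) j≡ k≤h
  some-vertex : Vertex j t
  some-vertex = fromℕ< (subst (0 <_) j≡ (s≤s z≤n)) , fromℕ< 0<t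
  star : (∃ λ u → deg u ≤ h * t) → HasBlueStar n c
  star (u , red≤ht) = blue-star c u (≤-trans n≤kt (low-red⇒high-blue c {k} {h} j≡ u red≤ht))

-- The lower bound

sideColouring : ∀ j t → ℕ → Colouring j t
sideColouring j t c = record
  { col = λ u x → firstParts c (proj₁ u) xor firstParts c (proj₁ x)
  ; sym = λ u x → xor-comm (firstParts c (proj₁ u)) (firstParts c (proj₁ x))
  }

xor-triangle : ∀ a b d → a xor b ≡ true → b xor d ≡ true → a xor d ≡ true → ⊥
xor-triangle true  true  _     ()
xor-triangle false false _     ()
xor-triangle true  false true  _  _  ()
xor-triangle true  false false _  ()
xor-triangle false true  true  _  ()
xor-triangle false true  false _  _  ()

sideColouring-no-red-triangle : ∀ j t c → ¬ HasRedK3 (sideColouring j t c)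
sideColouring-no-red-triangle j t c (a , b , d , _ , ab , bd , ad) =
  xor-triangle (side a) (side b) (side d) ab bd ad
  where
  side : Vertex j t → Bool
  side x = firstParts c (proj₁ x)

sideColouring-blue-≤ : ∀ {j t k h} → suc (k + h) ≡ j → h ≤ suc k → ∀ v →
                       countVertices (blueEdge (sideColouring j t (suc k)) v) ≤ k * t
sideColouring-blue-≤ {j} {t} {k} {h} j≡ h≤1+k v = begin
  countVertices (blueEdge (sideColouring j t (suc k)) v)
    ≡⟨ countVertices-byPart {t = t} (λ Q → distinct (proj₁ v) Q ∧ sameSide Q) ⟩
  count (λ Q → distinct (proj₁ v) Q ∧ sameSide Q) * t
    ≤⟨ *-monoˡ-≤ t (≤-pred (begin
      suc (count (λ Q → distinct (proj₁ v) Q ∧ sameSide Q))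
        ≡⟨ count-except sameSide (proj₁ v) v-sameSide ⟩
      count sameSide
        ≤⟨ count-side (side (proj₁ v)) ⟩
      suc k ∎)) ⟩
  k * t ∎
  where
  open ≤-Reasoning
  side : Fin j → Bool
  side = firstParts (suc k)
  sameSide : Fin j → Bool
  sameSide Q = not (side (proj₁ v) xor side Q)
  v-sameSide : T (sameSide (proj₁ v))
  v-sameSide = subst (T ∘ not) (sym (xor-same (side (proj₁ v)))) tt
  |side| : count side ≡ suc k
  |side| = count-firstParts (≤-trans (s≤s (m≤m+n k h)) (≤-reflexive j≡))
  count-side : ∀ s → count (λ Q → not (s xor side Q)) ≤ suc k
  count-side true =
    ≤-reflexive (trans (sum-cong-≗ λ Q → cong indicator (not-involutive (side Q))) |side|)
  count-side false = ≤-trans (≤-reflexive (+-cancelˡ-≡ (suc k) _ _ (begin-equality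
    suc k + count (not ∘ side)      ≡⟨ cong (_+ count (not ∘ side)) |side| ⟨
    count side + count (not ∘ side) ≡⟨ count-complement side ⟩
    j                               ≡⟨ j≡ ⟨
    suc k + h                       ∎))) h≤1+k

lower-bound : ∀ {j t n k h} → suc (k + h) ≡ j → h ≤ suc k → k * t < n → ¬ Arrows j t n
lower-bound {j} {t} {n} {k} j≡ h≤1+k kt<n arrows with arrows (sideColouring j t (suc k))
... | inj₁ triangle = sideColouring-no-red-triangle j t (suc k) triangle
... | inj₂ (v , f , f-inj , leaves) = <⇒≱ kt<n (≤-trans
  (injective⇒≤countVertices (blueEdge c v) f f-inj
     (λ i → uncurry (blueEdge-complete c {v} {f i}) (leaves i)))
  (sideColouring-blue-≤ j≡ h≤1+k v))
  where
  c : Colouring j t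
  c = sideColouring j t (suc k)

-- The Ramsey number

m≤n*[[m∸1]/n+1] : ∀ m n .{{_ : NonZero n}} → 1 ≤ m → m ≤ n * ((m ∸ 1) / n + 1)
m≤n*[[m∸1]/n+1] (suc m) n _ = begin
  suc m                    ≡⟨ cong suc (m≡m%n+[m/n]*n m n) ⟩
  suc (m % n + m / n * n)  ≤⟨ +-monoˡ-≤ (m / n * n) (m%n<n m n) ⟩
  n + m / n * n            ≡⟨ cong (n +_) (*-comm (m / n) n) ⟩
  n + n * (m / n)          ≡⟨ *-suc n (m / n) ⟨
  n * suc (m / n)          ≡⟨ cong (n *_) (+-comm 1 (m / n)) ⟩
  n * (m / n + 1)          ∎
  where open ≤-Reasoning

o<[m∸1]/n+1⇒n*o<m : ∀ {m n o} .{{_ : NonZero n}} → 1 ≤ m → o < (m ∸ 1) / n + 1 → n * o < m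
o<[m∸1]/n+1⇒n*o<m {suc m} {n} {o} _ o<q+1 = s≤s (begin
  n * o      ≤⟨ *-monoʳ-≤ n (m<1+n⇒m≤n (subst (o <_) (+-comm (m / n) 1) o<q+1)) ⟩
  n * (m / n) ≡⟨ *-comm n (m / n) ⟩
  m / n * n  ≤⟨ m/n*n≤m m n ⟩
  m          ∎)
  where open ≤-Reasoning

ramsey-number : ∀ {n k h} .{{_ : NonZero k}} → 2 ≤ n → k ≤ h → h ≤ suc k →
                IsSizeMultipartiteRamsey (suc (k + h)) n ((n ∸ 1) / k + 1)
ramsey-number {n} {k} 2≤n k≤h h≤1+k =
  m≤n+m 1 _ ,
  upper-bound refl k≤h (m≤n+m 1 _) (m≤n*[[m∸1]/n+1] n k 1≤n) ,
  λ t _ t<m → lower-bound refl h≤1+k (o<[m∸1]/n+1⇒n*o<m 1≤n t<m)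
  where
  1≤n : 1 ≤ n
  1≤n = ≤-trans (s≤s z≤n) 2≤n

halves : ∀ m → ∃₂ λ k h → k + h ≡ m × k ≤ h × h ≤ suc k × ceilHalf (suc m) ≡ suc k
halves 0 = 0 , 0 , refl , z≤n , z≤n , refl
halves 1 = 0 , 1 , refl , z≤n , s≤s z≤n , refl
halves (suc (suc m)) with halves m
... | k , h , k+h≡m , k≤h , h≤1+k , ceil≡ =
  suc k , suc h , cong suc (trans (+-suc k h) (cong suc k+h≡m)) , s≤s k≤h , s≤s h≤1+k ,
  trans (m/n≡1+[m∸n]/n {suc (suc (suc m)) + 1} {2} (s≤s (s≤s z≤n))) (cong suc ceil≡)

theorem6 : (n j : ℕ) → 2 ≤ n → 3 ≤ j →
    IsSizeMultipartiteRamsey j n (floorDiv (n ∸ 1) (ceilHalf j ∸ 1) + 1)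
theorem6 n (suc m) 2≤n 3≤j with halves m
... | zero , h , refl , _ , h≤1 , _ = ⊥-elim (≤⇒≯ h≤1 (≤-pred 3≤j))
... | suc k , h , refl , k≤h , h≤1+k , ceil≡ rewrite ceil≡ = ramsey-number 2≤n k≤h h≤1+k
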